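{- Let $\mathcal R=(R,\oplus,\le,0)$ be a distance magma and $S\subseteq R$ with $0\in S$. Then $\mathcal S^*=(S^*,\oplus^*,\le^*,0)$ is a distance magma.
   Context: A distance magma is a structure $(R,\oplus,\le,0)$ with $\oplus$ binary, $0\in R$, such that $\le$ is a total order, $r\le r\oplus s$, $r\le t,s\le u\Rightarrow r\oplus s\le t\oplus u$, $\oplus$ is commutative, and $r\oplus0=r=0\oplus r$. $\mathcal L_S$ is the relational language with a binary relation symbol $d(x,y)\le s$ for each $s\in S$; $d(x,y)>s$ denotes its negation. $T_{\mathrm{MS}}(S,\mathcal R)$ is the $\mathcal L_S$-theory consisting of: (MS1) $\forall x\forall y(d(x,y)\le 0\leftrightarrow x=y)$; (MS2) for $s\in S$, $\forall x\forall y(d(x,y)\le s\leftrightarrow d(y,x)\le s)$; (MS3) for $r,s,t\in S$ such that no $x\in S$ satisfies $t<x\le r\oplus s$, $\forall x\forall y\forall z((d(x,y)\le r\wedge d(y,z)\le s)\to d(x,z)\le t)$; (MS4) if $S$ has a maximum $s$, $\forall x\forall y\,d(x,y)\le s$. A cut in $S$ is an upward-closed subset $X\subseteq S$ that contains the maximum of $S$ if $S$ has one. $S^*$ is the set of cuts in $S$, ordered by $X\le^* Y$ iff $Y\subseteq X$; $r\in S$ is identified with the cut $\{x\in S:x\ge r\}$, so $0\in S^*$. For $\alpha\in S^*$, $p_\alpha(x,y)=\{d(x,y)\le s:s\in S,\alpha\le^* s\}\cup\{d(x,y)>s:s\in S,s<^*\alpha\}$. A triple $(\alpha,\beta,\gamma)\in(S^*)^3$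 is a logical $S^*$-triangle if $T_{\mathrm{MS}}(S,\mathcal R)\cup p_\alpha(x,y)\cup p_\beta(y,z)\cup p_\gamma(x,z)$ is consistent; $\Sigma(\alpha,\beta)$ is the set of $\gamma$ making $(\alpha,\beta,\gamma)$ a logical $S^*$-triangle, and $\alpha\oplus^*\beta=\sup\Sigma(\alpha,\beta)$ (supremum in the complete linear order $(S^*,\le^*)$). -}

module Defs where

open import Level using (Level; Lift; lift; lower; _⊔_) renaming (suc to lsuc; zero to lzero)
open import Data.Bool using (Bool; true; false)
open import Data.Product using (Σ; ∃; _×_; _,_; proj₁; proj₂)
open import Data.Empty using (⊥; ⊥-elim)
open import Relation.Nullary using (¬_; Dec; yes; no; does)
open import Relation.Unary using (Pred)
open import Relation.Binary.Core using (Rel)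
open import Relation.Binary.Structures using (IsTotalOrder)
open import Relation.Binary.PropositionalEquality using (_≡_; refl)
open import Algebra.Core using (Op₂)

-- A distance magma (R, ⊕, ≤, 0), stated relative to an equality _≈_
-- (propositional equality for R itself, pointwise equality for S*).
record IsDistanceMagma {a ℓ₁ ℓ₂} {A : Set a} (_≈_ : Rel A ℓ₁) (_≤_ : Rel A ℓ₂)
                       (_⊕_ : Op₂ A) (e : A) : Set (a ⊔ ℓ₁ ⊔ ℓ₂) where
  field
    isTotalOrder : IsTotalOrder _≈_ _≤_
    ⊕-cong       : ∀ {r s t u} → r ≈ t → s ≈ u → (r ⊕ s) ≈ (t ⊕ u)
    ≤⊕           : ∀ r s → r ≤ (r ⊕ s)
    ⊕-mono       : ∀ {r s t u} → r ≤ t → s ≤ u → (r ⊕ s) ≤ (t ⊕ u)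
    ⊕-comm       : ∀ r s → (r ⊕ s) ≈ (s ⊕ r)
    identityʳ    : ∀ r → (r ⊕ e) ≈ r
    identityˡ    : ∀ r → (e ⊕ r) ≈ r

-- Excluded middle (for propositions of level 1; lower ones via Lift).
LEM₁ : Set₂
LEM₁ = (P : Set₁) → Dec P

module Star (R : Set) (_⊕_ : Op₂ R) (_≤_ : Rel R lzero) (e : R)
            (dm : IsDistanceMagma _≡_ _≤_ _⊕_ e)
            (S : Pred R lzero) (0∈S : S e) (lem : LEM₁) where

  open IsDistanceMagma dm using (isTotalOrder)
  open IsTotalOrder isTotalOrder using (trans)

  dec-true : ∀ {P : Set₁} → P → does (lem P) ≡ true
  dec-true {P} p with lem P
  ... | yes _ = refl
  ... | no ¬p = ⊥-elim (¬p p)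

  true-dec : ∀ {P : Set₁} → does (lem P) ≡ true → P
  true-dec {P} eq with lem P
  true-dec {P} eq  | yes p = p
  true-dec {P} () | no _

  _<_ : R → R → Set
  x < y = (x ≤ y) × ¬ (x ≡ y)

  El : Set
  El = Σ R S

  val : El → R
  val = proj₁

  record Cut : Set where
    field
      mem    : El → Bool
      upward : ∀ {x y} → mem x ≡ true → val x ≤ val y → mem y ≡ true
      hasMax : ∀ m → (∀ x → val x ≤ val m) → mem m ≡ true
  open Cut public

  _≈*_ : Rel Cut lzero
  X ≈* Y = ∀ s → mem X s ≡ mem Y s

  _≤*_ : Rel Cut lzero
  X ≤* Y = ∀ s → mem Y s ≡ true → mem X s ≡ true

  _<*_ : Rel Cut lzero
  X <* Y = (X ≤* Y) × ¬ (X ≈* Y)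

  ι : El → Cut
  ι r = record
    { mem    = λ x → does (lem (Lift _ (val r ≤ val x)))
    ; upward = λ {x} {y} h x≤y →
        dec-true (lift (trans (lower (true-dec {Lift _ (val r ≤ val x)} h)) x≤y))
    ; hasMax = λ m isMax → dec-true (lift (isMax r))
    }

  0* : Cut
  0* = ι (e , 0∈S)

  -- L_S-structures: D x y s interprets "d(x,y) ≤ s" (only used for s ∈ S)
  record Model : Set₁ where
    field
      Carrier : Set
      D       : Carrier → Carrier → R → Set
      ms1 : ∀ x y → (D x y e → x ≡ y) × (x ≡ y → D x y e)
      ms2 : ∀ s → S s → ∀ x y → (D x y s → D y x s) × (D y x s → D x y s)
      ms3 : ∀ r s t → S r → S s → S t →
            ¬ (∃ λ x → S x × (t < x) × (x ≤ (r ⊕ s))) →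
            ∀ x y z → D x y r → D y z s → D x z t
      ms4 : ∀ m → S m → (∀ s → S s → s ≤ m) → ∀ x y → D x y m

  Realises : (M : Model) → Cut → Model.Carrier M → Model.Carrier M → Set
  Realises M α a b =
    (∀ (s : El) → α ≤* ι s → Model.D M a b (val s)) ×
    (∀ (s : El) → ι s <* α → ¬ Model.D M a b (val s))

  -- logical S*-triangle: T_MS ∪ p_α(x,y) ∪ p_β(y,z) ∪ p_γ(x,z) is consistent
  -- (read semantically, as satisfiable, via the completeness theorem)
  LogicalTriangle : Cut → Cut → Cut → Set₁
  LogicalTriangle α β γ =
    Σ Model λ M → Σ (Model.Carrier M) λ a → Σ (Model.Carrier M) λ b → Σ (Model.Carrier M) λ c →
      Realises M α a b × Realises M β b c × Realises M γ a c

  -- α ⊕* β = sup Σ(α,β) in (S*, ≤*), i.e. the intersection of the cuts in Σ(α,β)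
  _⊕*_ : Cut → Cut → Cut
  α ⊕* β = record
    { mem    = λ s → does (lem (∀ γ → LogicalTriangle α β γ → mem γ s ≡ true))
    ; upward = λ {x} {y} h x≤y → dec-true (λ γ t →
        upward γ (true-dec {∀ γ → LogicalTriangle α β γ → mem γ x ≡ true} h γ t) x≤y)
    ; hasMax = λ m isMax → dec-true (λ γ t → hasMax γ m isMax)
    }

-- Write α ⊞ β for the set of t ∈ S such that, for some r ∈ α and s ∈ β, no element of S lies in
-- the interval (t, r ⊕ s]. Axiom MS3 forces every γ ∈ Σ(α, β) to contain α ⊞ β, and α ⊞ β is
-- itself in Σ(α, β): it is realised by the three-point space with distances α, β and α ⊞ β
-- (collapsing a point when α or β is 0). Hence α ⊕* β = α ⊞ β, and the distance-magma laws for
-- ⊞ follow from those of ⊕ directly, while totality of ≤* is the usual comparison of cuts.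
module Submission where

open import Defs
open import Level using (Lift; lift; lower) renaming (zero to lzero)
open import Relation.Unary using (Pred)
open import Relation.Binary.Core using (Rel)
open import Relation.Binary.PropositionalEquality using (_≡_; refl; sym; trans; subst)
open import Relation.Binary.Structures using (IsTotalOrder)
open import Algebra.Core using (Op₂)
open import Data.Bool using (true; false) renaming (_≟_ to _≟ᵇ_)
open import Data.Bool.Properties using (⇔→≡)
open import Data.Product using (Σ; ∃; _×_; _,_; proj₂)
open import Data.Sum using (_⊎_; inj₁; inj₂)
open import Data.Unit using (⊤; tt)
open import Function using (_∘_; id)
open import Function.Bundles using (mk⇔)
open import Relation.Nullary using (¬_; yes; no; does; contradiction)
open import Relation.Nullary.Decidable using (decidable-stable)

module Cuts (R : Set) (_⊕_ : Op₂ R) (_≤_ : Rel R lzero) (e : R)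
            (dm : IsDistanceMagma _≡_ _≤_ _⊕_ e)
            (S : Pred R lzero) (0∈S : S e) (lem : LEM₁) where

  open Star R _⊕_ _≤_ e dm S 0∈S lem
  open IsDistanceMagma dm
  open IsTotalOrder isTotalOrder using (total; antisym)
    renaming (refl to ≤-refl; reflexive to ≤-reflexive; trans to ≤-trans)

  e≤ : ∀ r → e ≤ r
  e≤ r = subst (e ≤_) (identityˡ r) (≤⊕ e r)

  ≤⊕ʳ : ∀ r s → s ≤ (r ⊕ s)
  ≤⊕ʳ r s = subst (s ≤_) (⊕-comm s r) (≤⊕ s r)

  0ₛ : El
  0ₛ = e , 0∈S

  infix 4 _∈_ _∉_ _⊆_

  _∈_ : El → Cut → Set
  s ∈ X = mem X s ≡ true

  _∉_ : El → Cut → Set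
  s ∉ X = ¬ (s ∈ X)

  _⊆_ : Cut → Cut → Set
  X ⊆ Y = ∀ s → s ∈ X → s ∈ Y

  ∈-stable : ∀ X s → ¬ (s ∉ X) → s ∈ X
  ∈-stable X s = decidable-stable (mem X s ≟ᵇ true)

  ∈-irrelevant : ∀ X {r} (p q : S r) → (r , p) ∈ X → (r , q) ∈ X
  ∈-irrelevant X p q r∈X = upward X r∈X ≤-refl

  ∉⇒≤ : ∀ X {s t} → s ∉ X → t ∈ X → val s ≤ val t
  ∉⇒≤ X {s} {t} s∉X t∈X with total (val s) (val t)
  ... | inj₁ s≤t = s≤t
  ... | inj₂ t≤s = contradiction (upward X t∈X t≤s) s∉X

  0ₛ∈⇒full : ∀ X → 0ₛ ∈ X → ∀ s → s ∈ X
  0ₛ∈⇒full X 0ₛ∈X s = upward X 0ₛ∈X (e≤ (val s))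

  0*-full : ∀ s → s ∈ 0*
  0*-full s = dec-true (lift (e≤ (val s)))

  ⊆-trans : ∀ {X Y Z} → X ⊆ Y → Y ⊆ Z → X ⊆ Z
  ⊆-trans X⊆Y Y⊆Z s = Y⊆Z s ∘ X⊆Y s

  ⊆-antisym : ∀ {X Y} → X ⊆ Y → Y ⊆ X → X ≈* Y
  ⊆-antisym X⊆Y Y⊆X s = ⇔→≡ (mk⇔ (X⊆Y s) (Y⊆X s))

  ≈*⇒⊆ : ∀ {X Y} → X ≈* Y → X ⊆ Y
  ≈*⇒⊆ X≈Y s s∈X = trans (sym (X≈Y s)) s∈X

  ≤*-total : ∀ X Y → X ≤* Y ⊎ Y ≤* X
  ≤*-total X Y with lem (Lift _ (∃ λ s → s ∈ X × s ∉ Y))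
  ... | yes (lift (s , s∈X , s∉Y)) = inj₁ λ t t∈Y → upward X s∈X (∉⇒≤ Y s∉Y t∈Y)
  ... | no ¬sep = inj₂ λ s s∈X → ∈-stable Y s λ s∉Y → ¬sep (lift (s , s∈X , s∉Y))

  ≤*-isTotalOrder : IsTotalOrder _≈*_ _≤*_
  ≤*-isTotalOrder = record
    { isPartialOrder = record
      { isPreorder = record
        { isEquivalence = record
          { refl = λ {X} s → refl {x = mem X s}
          ; sym = λ {X} {Y} X≈Y s → sym (X≈Y s)
          ; trans = λ {X} {Y} {Z} X≈Y Y≈Z s → trans (X≈Y s) (Y≈Z s) }
        ; reflexive = λ {X} {Y} X≈Y → ≈*⇒⊆ {Y} {X} λ s → sym (X≈Y s)
        ; trans = λ {X} {Y} {Z} X≤Y Y≤Z → ⊆-trans {Z} {Y} {X} Y≤Z X≤Y }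
      ; antisym = λ {X} {Y} X≤Y Y≤X → ⊆-antisym {X} {Y} Y≤X X≤Y }
    ; total = ≤*-total }

  ∈ι-self : ∀ s → s ∈ ι s
  ∈ι-self s = dec-true (lift ≤-refl)

  ∈⇒ι⊆ : ∀ X {s} → s ∈ X → ι s ⊆ X
  ∈⇒ι⊆ X s∈X t t∈ιs = upward X s∈X (lower (true-dec t∈ιs))

  ∉⇒ι<* : ∀ X {s} → s ∉ X → ι s <* X
  ∉⇒ι<* X {s} s∉X =
    (λ t t∈X → dec-true (lift (∉⇒≤ X s∉X t∈X))) , λ ιs≈X → s∉X (≈*⇒⊆ {ι s} {X} ιs≈X s (∈ι-self s))

  ι<*⇒∉ : ∀ X {s} → ι s <* X → s ∉ X
  ι<*⇒∉ X {s} (X⊆ιs , ιs≉X) s∈X = ιs≉X (⊆-antisym {ι s} {X} (∈⇒ι⊆ X s∈X) X⊆ιs)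

  Gap : R → R → Set
  Gap t u = ¬ (∃ λ x → S x × (t < x) × (x ≤ u))

  Gap-intro : ∀ {t u} → (∀ x → S x → x ≤ u → x ≤ t) → Gap t u
  Gap-intro below (x , x∈S , (t≤x , t≢x) , x≤u) = t≢x (antisym t≤x (below x x∈S x≤u))

  ≤⇒Gap : ∀ {t u} → u ≤ t → Gap t u
  ≤⇒Gap u≤t = Gap-intro λ x _ x≤u → ≤-trans x≤u u≤t

  Gap-elim : ∀ {y t u} → S y → y ≤ u → Gap t u → y ≤ t
  Gap-elim {y} {t} y∈S y≤u gap with total y t
  ... | inj₁ y≤t = y≤t
  ... | inj₂ t≤y with lem (Lift _ (t ≡ y))
  ...   | yes (lift t≡y) = subst (_≤ t) t≡y ≤-refl
  ...   | no t≢y = contradiction (y , y∈S , (t≤y , t≢y ∘ lift) , y≤u) gap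

  Gap-mono : ∀ {t t′ u} → t ≤ t′ → Gap t u → Gap t′ u
  Gap-mono t≤t′ gap = Gap-intro λ x x∈S x≤u → ≤-trans (Gap-elim x∈S x≤u gap) t≤t′

  record Sum (α β : Cut) (t : El) : Set where
    constructor sum
    field
      {left right} : El
      left∈  : left ∈ α
      right∈ : right ∈ β
      gap    : Gap (val t) (val left ⊕ val right)

  Sum-up : ∀ α β {x y} → Sum α β x → val x ≤ val y → Sum α β y
  Sum-up α β (sum r∈α s∈β gap) x≤y = sum r∈α s∈β (Gap-mono x≤y gap)

  Sum-max : ∀ α β m → (∀ x → val x ≤ val m) → Sum α β m
  Sum-max α β m isMax =
    sum (hasMax α m isMax) (hasMax β m isMax) (Gap-intro λ x x∈S _ → isMax (x , x∈S))

  infixl 6 _⊞_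

  _⊞_ : Cut → Cut → Cut
  α ⊞ β = record
    { mem    = λ t → does (lem (Lift _ (Sum α β t)))
    ; upward = λ h x≤y → dec-true (lift (Sum-up α β (lower (true-dec h)) x≤y))
    ; hasMax = λ m isMax → dec-true (lift (Sum-max α β m isMax))
    }

  ∈⊞⁺ : ∀ {α β t} → Sum α β t → t ∈ α ⊞ β
  ∈⊞⁺ = dec-true ∘ lift

  ∈⊞⁻ : ∀ {α β t} → t ∈ α ⊞ β → Sum α β t
  ∈⊞⁻ = lower ∘ true-dec

  ⊞-mono : ∀ {α β γ δ} → α ⊆ γ → β ⊆ δ → α ⊞ β ⊆ γ ⊞ δ
  ⊞-mono α⊆γ β⊆δ t t∈α⊞β =
    let sum {r} {s} r∈α s∈β gap = ∈⊞⁻ t∈α⊞β in ∈⊞⁺ (sum (α⊆γ r r∈α) (β⊆δ s s∈β) gap)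

  ⊞-comm : ∀ {α β} → α ⊞ β ⊆ β ⊞ α
  ⊞-comm t t∈α⊞β =
    let sum {r} {s} r∈α s∈β gap = ∈⊞⁻ t∈α⊞β
    in ∈⊞⁺ (sum s∈β r∈α (subst (Gap (val t)) (⊕-comm (val r) (val s)) gap))

  ⊞⊆ˡ : ∀ {α β} → α ⊞ β ⊆ α
  ⊞⊆ˡ {α} t t∈α⊞β =
    let sum {r} {s} r∈α _ gap = ∈⊞⁻ t∈α⊞β
    in upward α r∈α (Gap-elim (proj₂ r) (≤⊕ (val r) (val s)) gap)

  ⊞⊆ʳ : ∀ {α β} → α ⊞ β ⊆ β
  ⊞⊆ʳ {α} {β} = ⊆-trans {α ⊞ β} {β ⊞ α} {β} ⊞-comm ⊞⊆ˡ

  ⊞-identityˡ : ∀ {α β} → 0ₛ ∈ α → β ⊆ α ⊞ β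
  ⊞-identityˡ 0ₛ∈α t t∈β = ∈⊞⁺ (sum 0ₛ∈α t∈β (≤⇒Gap (≤-reflexive (identityˡ (val t)))))

  ⊞-identityʳ : ∀ {α β} → 0ₛ ∈ β → α ⊆ α ⊞ β
  ⊞-identityʳ {α} {β} 0ₛ∈β = ⊆-trans {α} {β ⊞ α} {α ⊞ β} (⊞-identityˡ 0ₛ∈β) ⊞-comm

  record Triangular (X Y Z : Cut) : Set where
    constructor triangular
    field
      bound : ∀ r s t → r ∈ X → s ∈ Y → Gap (val t) (val r ⊕ val s) → t ∈ Z
  open Triangular

  Triangular-swap : ∀ {X Y Z} → Triangular X Y Z → Triangular Y X Z
  Triangular-swap tri = triangular λ r s t r∈Y s∈X gap →
    bound tri s r t s∈X r∈Y (subst (Gap (val t)) (⊕-comm (val r) (val s)) gap)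

  Triangular-⊆ : ∀ {X Y Z} → Y ⊆ Z → Triangular X Y Z
  Triangular-⊆ {Z = Z} Y⊆Z = triangular λ r s t _ s∈Y gap →
    upward Z (Y⊆Z s s∈Y) (Gap-elim (proj₂ s) (≤⊕ʳ (val r) (val s)) gap)

  Triangular-0* : ∀ {X Y} → Triangular X Y 0*
  Triangular-0* = triangular λ _ _ t _ _ _ → 0*-full t

  Triangular-⊞ : ∀ α β → Triangular α β (α ⊞ β)
  Triangular-⊞ α β = triangular λ _ _ _ r∈α s∈β gap → ∈⊞⁺ (sum r∈α s∈β gap)

  Triangular⇒⊞⊆ : ∀ {α β γ} → Triangular α β γ → α ⊞ β ⊆ γ
  Triangular⇒⊞⊆ tri t t∈α⊞β =
    let sum {r} {s} r∈α s∈β gap = ∈⊞⁻ t∈α⊞β in bound tri r s t r∈α s∈β gap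

  false⇒∉ : ∀ X {s} → mem X s ≡ false → s ∉ X
  false⇒∉ X eq s∈X with trans (sym s∈X) eq
  ... | ()

  record HasDistance (M : Model) (a b : Model.Carrier M) (X : Cut) : Set where
    constructor hasDistance
    field
      ∈⇒D : ∀ s → s ∈ X → Model.D M a b (val s)
      D⇒∈ : ∀ s → Model.D M a b (val s) → s ∈ X
  open HasDistance

  Realises-∈ : ∀ M {X a b} → Realises M X a b → ∀ s → s ∈ X → Model.D M a b (val s)
  Realises-∈ M {X} (dist≤ , _) s s∈X = dist≤ s (∈⇒ι⊆ X s∈X)

  Realises-∉ : ∀ M {X a b} → Realises M X a b → ∀ s → s ∉ X → ¬ Model.D M a b (val s)
  Realises-∉ M {X} (_ , dist≰) s s∉X = dist≰ s (∉⇒ι<* X s∉X)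

  HasDistance⇒Realises : ∀ M {X a b} → HasDistance M a b X → Realises M X a b
  HasDistance⇒Realises M {X} d =
    (λ s X≤ιs → ∈⇒D d s (X≤ιs s (∈ι-self s))) , λ s ιs<X → ι<*⇒∉ X ιs<X ∘ D⇒∈ d s

  HasDistance-resp : ∀ M {X Y a b} → X ⊆ Y → Y ⊆ X → HasDistance M a b X → HasDistance M a b Y
  HasDistance-resp M X⊆Y Y⊆X d = hasDistance (λ s → ∈⇒D d s ∘ Y⊆X s) (λ s → X⊆Y s ∘ D⇒∈ d s)

  -- MS3 with r = s = 0 propagates d(a,a) ≤ 0 to every bound in S.
  D-refl : ∀ M a {s} → S s → Model.D M a a s
  D-refl M a {s} s∈S = ms3 e e s 0∈S 0∈S s∈S gap a a a Daa Daa
    where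
    open Model M
    Daa : D a a e
    Daa = proj₂ (ms1 a a) refl
    gap : Gap s (e ⊕ e)
    gap = ≤⇒Gap (≤-trans (≤-reflexive (identityʳ e)) (e≤ s))

  HasDistance-self : ∀ M {X a} → 0ₛ ∈ X → HasDistance M a a X
  HasDistance-self M {X} {a} 0ₛ∈X =
    hasDistance (λ s _ → D-refl M a (proj₂ s)) (λ s _ → 0ₛ∈⇒full X 0ₛ∈X s)

  HasDistance⇒LogicalTriangle : ∀ M {α β γ a b c} →
    HasDistance M a b α → HasDistance M b c β → HasDistance M a c γ → LogicalTriangle α β γ
  HasDistance⇒LogicalTriangle M {a = a} {b} {c} ab bc ac =
    M , a , b , c , HasDistance⇒Realises M ab , HasDistance⇒Realises M bc , HasDistance⇒Realises M ac

  triangle⇒Triangular : ∀ {α β γ} → LogicalTriangle α β γ → Triangular α β γ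
  triangle⇒Triangular {α} {β} {γ} (M , a , b , c , ab , bc , ac) = triangular λ r s t r∈α s∈β gap →
    ∈-stable γ t λ t∉γ → Realises-∉ M {γ} ac t t∉γ
      (Model.ms3 M (val r) (val s) (val t) (proj₂ r) (proj₂ s) (proj₂ t) gap a b c
        (Realises-∈ M {α} ab r r∈α) (Realises-∈ M {β} bc s s∈β))

  record CutMetric : Set₁ where
    field
      Point      : Set
      dist       : Point → Point → Cut
      dist-sym   : ∀ x y → dist x y ≡ dist y x
      dist-self  : ∀ x → 0ₛ ∈ dist x x
      dist-sep   : ∀ x y → 0ₛ ∈ dist x y → x ≡ y
      dist-triangular : ∀ x y z → Triangular (dist x y) (dist y z) (dist x z)

    D : Point → Point → R → Set
    D x y r = Σ (S r) λ r∈S → (r , r∈S) ∈ dist x y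

    D-sym : ∀ x y {r} → D x y r → D y x r
    D-sym x y (r∈S , r∈) = r∈S , subst (λ Z → _ ∈ Z) (dist-sym x y) r∈

    model : Model
    model = record
      { Carrier = Point
      ; D       = D
      ; ms1     = λ x y → (λ (e∈S , e∈) → dist-sep x y (∈-irrelevant (dist x y) e∈S 0∈S e∈))
                        , λ { refl → 0∈S , dist-self x }
      ; ms2     = λ _ _ x y → D-sym x y , D-sym y x
      ; ms3     = λ r s t _ _ t∈S gap x y z (r∈S , r∈) (s∈S , s∈) →
                    t∈S , bound (dist-triangular x y z) (r , r∈S) (s , s∈S) (t , t∈S) r∈ s∈ gap
      ; ms4     = λ m m∈S isMax x y → m∈S , hasMax (dist x y) (m , m∈S) λ u → isMax (val u) (proj₂ u)
      }

    dist-realised : ∀ x y → HasDistance model x y (dist x y)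
    dist-realised x y = hasDistance (λ s s∈ → proj₂ s , s∈)
                                    λ s (r∈S , s∈) → ∈-irrelevant (dist x y) r∈S (proj₂ s) s∈

  data Corner : Set where
    A B C : Corner

  triangleMetric : ∀ α β → 0ₛ ∉ α → 0ₛ ∉ β → CutMetric
  triangleMetric α β 0ₛ∉α 0ₛ∉β = record
    { Point = Corner ; dist = dist
    ; dist-sym = sym′ ; dist-self = self ; dist-sep = sep ; dist-triangular = tri }
    where
    dist : Corner → Corner → Cut
    dist A A = 0*
    dist A B = α
    dist A C = α ⊞ β
    dist B A = α
    dist B B = 0*
    dist B C = β
    dist C A = α ⊞ β
    dist C B = β
    dist C C = 0*

    sym′ : ∀ x y → dist x y ≡ dist y x
    sym′ A A = refl
    sym′ A B = refl
    sym′ A C = refl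
    sym′ B A = refl
    sym′ B B = refl
    sym′ B C = refl
    sym′ C A = refl
    sym′ C B = refl
    sym′ C C = refl

    self : ∀ x → 0ₛ ∈ dist x x
    self A = 0*-full 0ₛ
    self B = 0*-full 0ₛ
    self C = 0*-full 0ₛ

    sep : ∀ x y → 0ₛ ∈ dist x y → x ≡ y
    sep A A _ = refl
    sep B B _ = refl
    sep C C _ = refl
    sep A B 0ₛ∈ = contradiction 0ₛ∈ 0ₛ∉α
    sep B A 0ₛ∈ = contradiction 0ₛ∈ 0ₛ∉α
    sep B C 0ₛ∈ = contradiction 0ₛ∈ 0ₛ∉β
    sep C B 0ₛ∈ = contradiction 0ₛ∈ 0ₛ∉β
    sep A C 0ₛ∈ = contradiction (⊞⊆ˡ _ 0ₛ∈) 0ₛ∉α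
    sep C A 0ₛ∈ = contradiction (⊞⊆ˡ _ 0ₛ∈) 0ₛ∉α

    tri : ∀ x y z → Triangular (dist x y) (dist y z) (dist x z)
    tri A B C = Triangular-⊞ α β
    tri C B A = Triangular-swap (Triangular-⊞ α β)
    tri A C B = Triangular-swap (Triangular-⊆ ⊞⊆ˡ)
    tri B C A = Triangular-⊆ ⊞⊆ˡ
    tri B A C = Triangular-⊆ ⊞⊆ʳ
    tri C A B = Triangular-swap (Triangular-⊆ ⊞⊆ʳ)
    tri A A z = Triangular-⊆ λ _ → id
    tri B B z = Triangular-⊆ λ _ → id
    tri C C z = Triangular-⊆ λ _ → id
    tri x A A = Triangular-swap (Triangular-⊆ λ _ → id)
    tri x B B = Triangular-swap (Triangular-⊆ λ _ → id)
    tri x C C = Triangular-swap (Triangular-⊆ λ _ → id)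
    tri A y A = Triangular-0*
    tri B y B = Triangular-0*
    tri C y C = Triangular-0*

  pointModel : Model
  pointModel = record
    { Carrier = ⊤
    ; D       = λ _ _ → S
    ; ms1     = λ _ _ → (λ _ → refl) , λ _ → 0∈S
    ; ms2     = λ _ _ _ _ → id , id
    ; ms3     = λ _ _ _ _ _ t∈S _ _ _ _ _ _ → t∈S
    ; ms4     = λ _ m∈S _ _ _ → m∈S
    }

  realisable : ∀ X →
    Σ Model λ M → Σ (Model.Carrier M) λ a → Σ (Model.Carrier M) λ b → HasDistance M a b X
  realisable X with mem X 0ₛ in 0ₛ∈?X
  ... | true  = pointModel , tt , tt , HasDistance-self pointModel 0ₛ∈?X
  ... | false = model , A , B , dist-realised A B
    where open CutMetric (triangleMetric X X (false⇒∉ X 0ₛ∈?X) (false⇒∉ X 0ₛ∈?X))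

  ⊞-triangle : ∀ α β → LogicalTriangle α β (α ⊞ β)
  ⊞-triangle α β with mem α 0ₛ in 0ₛ∈?α | mem β 0ₛ in 0ₛ∈?β
  ... | true | _ =
    let M , b , c , bc = realisable β
    in HasDistance⇒LogicalTriangle M {α} {β} {α ⊞ β} (HasDistance-self M 0ₛ∈?α) bc
         (HasDistance-resp M (⊞-identityˡ {α} {β} 0ₛ∈?α) ⊞⊆ʳ bc)
  ... | false | true =
    let M , a , b , ab = realisable α
    in HasDistance⇒LogicalTriangle M {α} {β} {α ⊞ β} ab (HasDistance-self M 0ₛ∈?β)
         (HasDistance-resp M (⊞-identityʳ {α} {β} 0ₛ∈?β) ⊞⊆ˡ ab)
  ... | false | false =
    HasDistance⇒LogicalTriangle model (dist-realised A B) (dist-realised B C) (dist-realised A C)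
    where open CutMetric (triangleMetric α β (false⇒∉ α 0ₛ∈?α) (false⇒∉ β 0ₛ∈?β))

  ⊕*⊆⊞ : ∀ {α β} → α ⊕* β ⊆ α ⊞ β
  ⊕*⊆⊞ {α} {β} t t∈α⊕*β = true-dec t∈α⊕*β (α ⊞ β) (⊞-triangle α β)

  ⊞⊆⊕* : ∀ {α β} → α ⊞ β ⊆ α ⊕* β
  ⊞⊆⊕* {α} {β} t t∈α⊞β =
    dec-true λ γ αβγ → Triangular⇒⊞⊆ {α} {β} (triangle⇒Triangular {α} {β} {γ} αβγ) t t∈α⊞β

  ⊕*-mono : ∀ {α β γ δ} → α ⊆ γ → β ⊆ δ → α ⊕* β ⊆ γ ⊕* δ
  ⊕*-mono {α} {β} {γ} {δ} α⊆γ β⊆δ t =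
    ⊞⊆⊕* {γ} {δ} t ∘ ⊞-mono {α} {β} {γ} {δ} α⊆γ β⊆δ t ∘ ⊕*⊆⊞ {α} {β} t

  ⊕*-comm : ∀ α β → α ⊕* β ⊆ β ⊕* α
  ⊕*-comm α β t = ⊞⊆⊕* {β} {α} t ∘ ⊞-comm {α} {β} t ∘ ⊕*⊆⊞ {α} {β} t

  ⊕*⊆ˡ : ∀ α β → α ⊕* β ⊆ α
  ⊕*⊆ˡ α β t = ⊞⊆ˡ {α} {β} t ∘ ⊕*⊆⊞ {α} {β} t

  ⊕*-identityʳ : ∀ α → (α ⊕* 0*) ≈* α
  ⊕*-identityʳ α = ⊆-antisym {α ⊕* 0*} {α} (⊕*⊆ˡ α 0*)
    λ t → ⊞⊆⊕* {α} {0*} t ∘ ⊞-identityʳ {α} {0*} (0*-full 0ₛ) t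

  ⊕*-identityˡ : ∀ α → (0* ⊕* α) ≈* α
  ⊕*-identityˡ α = ⊆-antisym {0* ⊕* α} {α} (λ t → ⊞⊆ʳ {0*} {α} t ∘ ⊕*⊆⊞ {0*} {α} t)
    λ t → ⊞⊆⊕* {0*} {α} t ∘ ⊞-identityˡ {0*} {α} (0*-full 0ₛ) t

  ⊕*-cong : ∀ {α β γ δ} → α ≈* γ → β ≈* δ → (α ⊕* β) ≈* (γ ⊕* δ)
  ⊕*-cong {α} {β} {γ} {δ} α≈γ β≈δ = ⊆-antisym {α ⊕* β} {γ ⊕* δ}
    (⊕*-mono {α} {β} {γ} {δ} (≈*⇒⊆ {α} {γ} α≈γ) (≈*⇒⊆ {β} {δ} β≈δ))
    (⊕*-mono {γ} {δ} {α} {β} (≈*⇒⊆ {γ} {α} (sym ∘ α≈γ)) (≈*⇒⊆ {δ} {β} (sym ∘ β≈δ)))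

  isDistanceMagma : IsDistanceMagma _≈*_ _≤*_ _⊕*_ 0*
  isDistanceMagma = record
    { isTotalOrder = ≤*-isTotalOrder
    ; ⊕-cong       = λ {α} {β} {γ} {δ} → ⊕*-cong {α} {β} {γ} {δ}
    ; ≤⊕           = ⊕*⊆ˡ
    ; ⊕-mono       = λ {α} {β} {γ} {δ} γ⊆α δ⊆β → ⊕*-mono {γ} {δ} {α} {β} γ⊆α δ⊆β
    ; ⊕-comm       = λ α β → ⊆-antisym {α ⊕* β} {β ⊕* α} (⊕*-comm α β) (⊕*-comm β α)
    ; identityʳ    = ⊕*-identityʳ
    ; identityˡ    = ⊕*-identityˡ
    }

theorem2p13 : (lem : LEM₁) (R : Set) (_⊕_ : Op₂ R) (_≤_ : Rel R lzero) (e : R)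
              (dm : IsDistanceMagma _≡_ _≤_ _⊕_ e)
              (S : Pred R lzero) (0∈S : S e) →
              let open Star R _⊕_ _≤_ e dm S 0∈S lem in
              IsDistanceMagma _≈*_ _≤*_ _⊕*_ 0*
theorem2p13 lem R _⊕_ _≤_ e dm S 0∈S = Cuts.isDistanceMagma R _⊕_ _≤_ e dm S 0∈S lem
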